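{- For all integers $n\ge 3$ and $p\ge 2$, $$C_2(C_n\circledcirc K_p)=\left\lfloor \frac{3n+3}{4}\right\rfloor = n-\left\lfloor \frac{n}{4}\right\rfloor .$$
   Context: Irreversible $k$-threshold process on a finite simple graph $G=(V,E)$: start with a set $S_0\subseteq V$ of colored vertices; for $t\ge1$, $S_t$ consists of $S_{t-1}$ together with every vertex having at least $k$ neighbors in $S_{t-1}$. $S_0$ is an irreversible $k$-threshold conversion set if $S_t=V$ for some $t\ge 0$. $C_k(G)$ is the minimum size of such a set. Double corona product $C_n\circledcirc K_p$ (written $C_n$ double-odot $K_p$ in the paper): its vertices are $v_1,\dots,v_n$, $w_1,\dots,w_n$ and $u_i^j$ ($1\le i\le n$, $1\le j\le p$). Edges: $v_1\cdots v_n$ forms a cycle $C_n$; $w_1\cdots w_n$ forms a second cycle $C_n$; for each $i$ the vertices $u_i^1,\dots,u_i^p$ form a complete graph $K_p$; and for each $i$, both $v_i$ and $w_i$ are joined to every $u_i^j$, $1\le j\le p$. There are no other edges (in particular $v_i$ and $w_i$ are not adjacent). It has $n(p+2)$ vertices. -}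

module Defs where

open import Data.Nat using (ℕ; zero; suc; _+_; _≤_; _≤ᵇ_; _≡ᵇ_; _%_)
open import Data.Nat.Properties using ()
open import Data.Bool using (Bool; true; false; _∧_; _∨_; not; if_then_else_)
open import Data.Fin using (Fin; toℕ)
open import Data.List using (List; []; _∷_; map; concatMap; _++_; allFin)
open import Data.Nat.ListAction using (sum)
open import Data.Product using (Σ; ∃; _×_; _,_)
open import Relation.Binary.PropositionalEquality using (_≡_)

-- A finite simple graph: a vertex type together with a list enumerating
-- every vertex exactly once, and a Boolean (decidable) adjacency relation
-- (symmetry/irreflexivity are not recorded as fields; the concrete graph
-- below is visibly symmetric and loop-free for n ≥ 3).
record FinGraph : Set₁ where
  field
    V        : Set
    vertices : List V
    adj      : V → V → Bool

module _ (G : FinGraph) where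
  open FinGraph G

  VSet : Set
  VSet = V → Bool

  size : VSet → ℕ
  size S = sum (map (λ y → if S y then 1 else 0) vertices)

  nbrsIn : VSet → V → ℕ
  nbrsIn S x = sum (map (λ y → if adj x y ∧ S y then 1 else 0) vertices)

  step : ℕ → VSet → VSet
  step k S x = S x ∨ (k ≤ᵇ nbrsIn S x)

  iter : ℕ → VSet → ℕ → VSet
  iter k S zero    = S
  iter k S (suc t) = step k (iter k S t)

  IsConversionSet : ℕ → VSet → Set
  IsConversionSet k S = ∃ λ t → ∀ x → iter k S t x ≡ true

  ConvNumberIs : ℕ → ℕ → Set
  ConvNumberIs k m =
    (∃ λ S → IsConversionSet k S × size S ≡ m)
    × (∀ S → IsConversionSet k S → m ≤ size S)

_==_ : ∀ {n} → Fin n → Fin n → Bool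
i == j = toℕ i ≡ᵇ toℕ j

cycAdj : ∀ {n} → Fin n → Fin n → Bool
cycAdj {zero}  ()
cycAdj {suc m} i j =
  ((suc (toℕ i) % suc m) ≡ᵇ toℕ j) ∨ ((suc (toℕ j) % suc m) ≡ᵇ toℕ i)

data DCVertex (n p : ℕ) : Set where
  v : Fin n → DCVertex n p
  w : Fin n → DCVertex n p
  u : Fin n → Fin p → DCVertex n p

dcVertices : (n p : ℕ) → List (DCVertex n p)
dcVertices n p =
  map v (allFin n) ++ map w (allFin n)
    ++ concatMap (λ i → map (u i) (allFin p)) (allFin n)

dcAdj : ∀ {n p} → DCVertex n p → DCVertex n p → Bool
dcAdj (v i)   (v j)   = cycAdj i j
dcAdj (w i)   (w j)   = cycAdj i j
dcAdj (u i a) (u j b) = (i == j) ∧ not (a == b)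
dcAdj (v i)   (u j _) = i == j
dcAdj (u i _) (v j)   = i == j
dcAdj (w i)   (u j _) = i == j
dcAdj (u i _) (w j)   = i == j
dcAdj (v _)   (w _)   = false
dcAdj (w _)   (v _)   = false

DoubleCorona : ℕ → ℕ → FinGraph
DoubleCorona n p = record
  { V = DCVertex n p ; vertices = dcVertices n p ; adj = dcAdj }

{-# OPTIONS --safe #-}
-- Call v k, w k and the clique vertices u k j the k-th gadget, and the number of seeds in it
-- its load.  A seed-free vertex set in which every vertex has at most one neighbour outside
-- the set is never colored, since each of its vertices sees at most one colored neighbour.
-- Such shields exist when two consecutive gadgets have unseeded w-rims and cliques (or
-- unseeded v-rims and cliques), and when a run of gadgets with unseeded rims and at most one
-- seed per clique lies between two unseeded gadgets.  Hence, for a conversion set, a gadget of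
-- load one next to an unseeded gadget has its seed in the clique, no unseeded gadget is
-- followed by zero, one or two gadgets of load one and then another unseeded gadget, and so
-- every four consecutive gadgets carry at least three seeds; summing over the n rotations
-- gives 4|S| ≥ 3n.
--
-- Conversely, seed v, one clique vertex, nothing, one clique vertex in the gadgets
-- 0, 1, 2, 3 mod 4, except for a clique vertex in the last gadget.  A clique-seeded gadget
-- gets its v-rim from a v-seeded neighbour (possibly through the next clique-seeded gadget),
-- then its clique and its w-rim; every other gadget lies between two clique-seeded gadgets and
-- takes both rims from them.  This uses n ∸ ⌊n/4⌋ = ⌊(3n+3)/4⌋ seeds.

module Submission where

open import Defs
open import Data.Bool using (Bool; true; false; _∧_; _∨_; not; if_then_else_)
import Data.Bool as Bool
open import Data.Bool.Properties using (∨-zeroʳ; ∧-conicalˡ; ∧-conicalʳ; ¬-not; T-≡)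
open import Data.Empty using (⊥; ⊥-elim)
open import Data.Fin using (Fin; zero; suc; toℕ; fromℕ; fromℕ<; inject₁)
open import Data.Fin.Permutation using (permutation)
open import Data.Fin.Properties using (toℕ-injective; toℕ-fromℕ<; toℕ-fromℕ; toℕ-inject₁; toℕ<n; any?)
import Data.Fin.Properties as Fin
open import Data.List using (List; []; _∷_; map; concatMap; _++_; allFin; tabulate; cartesianProductWith)
open import Data.List.Membership.Propositional using (_∈_)
open import Data.List.Membership.Propositional.Properties
  using (∈-map⁺; ∈-map⁻; ∈-++⁺ˡ; ∈-++⁺ʳ; ∈-++⁻; ∈-allFin; ∈-concat⁺′; ∈-cartesianProductWith⁻)
open import Data.List.Relation.Binary.Disjoint.Propositional using (Disjoint)
open import Data.List.Relation.Binary.Pointwise using (Pointwise; []; _∷_)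
open import Data.List.Properties using (map-++; map-tabulate)
open import Data.List.Relation.Unary.All as All using (All; []; _∷_)
open import Data.List.Relation.Unary.Any using (here; there)
open import Data.List.Relation.Unary.Unique.Propositional using (Unique)
open import Data.List.Relation.Unary.Unique.Propositional.Properties
  using (++⁺; map⁺; allFin⁺; cartesianProductWith⁺)
open import Data.List.Relation.Unary.AllPairs using ([]; _∷_)
open import Data.Nat
open import Data.Nat.DivMod
open import Data.Nat.Divisibility using (divides)
open import Data.Nat.GeneralisedArithmetic using (fold)
open import Data.Nat.ListAction using (sum)
open import Data.Nat.ListAction.Properties using (sum-++)
open import Data.Nat.Properties
open import Data.Product using (∃; _×_; _,_; proj₁; proj₂)
open import Data.Sum using (_⊎_; inj₁; inj₂)
open import Function using (_∘_; id; Equivalence)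
open import Relation.Binary.PropositionalEquality
open import Relation.Nullary using (¬_; yes; no; does; contradiction)
open import Relation.Nullary.Decidable using (dec-true; dec-false)

open import Algebra.Properties.CommutativeMonoid.Sum +-0-commutativeMonoid
  using (sum-syntax; sum-cong-≗; ∑-distrib-+; ∑-comm; ∑-permute; sum-init-last)

𝟙 : Bool → ℕ
𝟙 b = if b then 1 else 0

-- size G S and nbrsIn G S x unfold to countᵇ over the vertex list.
countᵇ : {A : Set} → (A → Bool) → List A → ℕ
countᵇ P xs = sum (map (𝟙 ∘ P) xs)

module _ {A : Set} {P : A → Bool} where

  countᵇ-≥1 : ∀ {x xs} → x ∈ xs → P x ≡ true → 1 ≤ countᵇ P xs
  countᵇ-≥1 (here refl) Px rewrite Px = z<s
  countᵇ-≥1 {xs = y ∷ _} (there x∈) Px = ≤-trans (countᵇ-≥1 x∈ Px) (m≤n+m _ (𝟙 (P y)))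

  countᵇ-≡0 : ∀ {x xs} → countᵇ P xs ≡ 0 → x ∈ xs → P x ≡ false
  countᵇ-≡0 none x∈ = ¬-not λ Px → 1+n≰n (subst (1 ≤_) none (countᵇ-≥1 x∈ Px))

  countᵇ-≥2 : ∀ {x y xs} → x ∈ xs → y ∈ xs → x ≢ y → P x ≡ true → P y ≡ true →
              2 ≤ countᵇ P xs
  countᵇ-≥2 (here refl) (here refl)  x≢y _  _  = contradiction refl x≢y
  countᵇ-≥2 (here refl) (there y∈)   _   Px Py rewrite Px = s≤s (countᵇ-≥1 y∈ Py)
  countᵇ-≥2 (there x∈)  (here refl)  _   Px Py rewrite Py = s≤s (countᵇ-≥1 x∈ Px)
  countᵇ-≥2 {xs = z ∷ _} (there x∈) (there y∈) x≢y Px Py =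
    ≤-trans (countᵇ-≥2 x∈ y∈ x≢y Px Py) (m≤n+m _ (𝟙 (P z)))

  countᵇ-≤1 : ∀ {xs} → Unique xs → (∀ {x y} → P x ≡ true → P y ≡ true → x ≡ y) →
              countᵇ P xs ≤ 1
  countᵇ-≤1 [] _ = z≤n
  countᵇ-≤1 {x ∷ xs} (x∉xs ∷ uniq) single with P x in Px
  ... | false = countᵇ-≤1 uniq single
  ... | true  = s≤s (≤-reflexive (countᵇ-all-false (All.map (λ x≢y → ¬-not (x≢y ∘ single Px)) x∉xs)))
    where
      countᵇ-all-false : ∀ {ys} → All (λ y → P y ≡ false) ys → countᵇ P ys ≡ 0
      countᵇ-all-false [] = refl
      countᵇ-all-false (Py ∷ Pys) rewrite Py = countᵇ-all-false Pys

≡ᵇ-true⇒≡ : ∀ {a b} → (a ≡ᵇ b) ≡ true → a ≡ b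
≡ᵇ-true⇒≡ {a} {b} e = ≡ᵇ⇒≡ a b (Equivalence.from T-≡ e)

≡⇒≡ᵇ-true : ∀ {a b} → a ≡ b → (a ≡ᵇ b) ≡ true
≡⇒≡ᵇ-true {a} {b} e = Equivalence.to T-≡ (≡⇒≡ᵇ a b e)

==⇒≡ : ∀ {n} {i j : Fin n} → (i == j) ≡ true → i ≡ j
==⇒≡ = toℕ-injective ∘ ≡ᵇ-true⇒≡

≡⇒== : ∀ {n} {i j : Fin n} → i ≡ j → (i == j) ≡ true
≡⇒== = ≡⇒≡ᵇ-true ∘ cong toℕ

∑-mono-≤ : ∀ {n} {f g : Fin n → ℕ} → (∀ i → f i ≤ g i) → ∑[ i < n ] f i ≤ ∑[ i < n ] g i
∑-mono-≤ {zero}  _   = z≤n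
∑-mono-≤ {suc n} f≤g = +-mono-≤ (f≤g zero) (∑-mono-≤ (f≤g ∘ suc))

∑-const : ∀ n c → ∑[ i < n ] c ≡ n * c
∑-const zero    c = refl
∑-const (suc n) c = cong (c +_) (∑-const n c)

sum-map-++ : ∀ {A : Set} (f : A → ℕ) xs ys → sum (map f (xs ++ ys)) ≡ sum (map f xs) + sum (map f ys)
sum-map-++ f xs ys = trans (cong sum (map-++ f xs ys)) (sum-++ (map f xs) (map f ys))

sum-map-tabulate : ∀ {A : Set} {n} (f : A → ℕ) (g : Fin n → A) →
                   sum (map f (tabulate g)) ≡ ∑[ i < n ] f (g i)
sum-map-tabulate {n = zero}  f g = refl
sum-map-tabulate {n = suc n} f g = cong (f (g zero) +_) (sum-map-tabulate f (g ∘ suc))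

sum-map-concatMap : ∀ {A B : Set} {n} (f : B → ℕ) (h : A → List B) (g : Fin n → A) →
                    sum (map f (concatMap h (tabulate g))) ≡ ∑[ i < n ] sum (map f (h (g i)))
sum-map-concatMap {n = zero}  f h g = refl
sum-map-concatMap {n = suc n} f h g =
  trans (sum-map-++ f (h (g zero)) _) (cong (_ +_) (sum-map-concatMap f h (g ∘ suc)))

sum-map-map-allFin : ∀ {A : Set} {n} (f : A → ℕ) (g : Fin n → A) →
                     sum (map f (map g (allFin n))) ≡ ∑[ i < n ] f (g i)
sum-map-map-allFin f g = trans (cong (sum ∘ map f) (map-tabulate id g)) (sum-map-tabulate f g)

concatMap-map≡cartesianProductWith : ∀ {A B C : Set} (f : A → B → C) xs ys →
  concatMap (λ x → map (f x) ys) xs ≡ cartesianProductWith f xs ys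
concatMap-map≡cartesianProductWith f []       ys = refl
concatMap-map≡cartesianProductWith f (x ∷ xs) ys =
  cong (map (f x) ys ++_) (concatMap-map≡cartesianProductWith f xs ys)

sum-mono-≤ : ∀ {xs ys} → Pointwise _≤_ xs ys → sum xs ≤ sum ys
sum-mono-≤ []           = z≤n
sum-mono-≤ (x≤y ∷ xs≤ys) = +-mono-≤ x≤y (sum-mono-≤ xs≤ys)

-- The 2-threshold process on a finite graph

module Process (G : FinGraph) where
  open FinGraph G

  iter-mono′ : ∀ {k S t t′ x} → t ≤′ t′ → iter G k S t x ≡ true → iter G k S t′ x ≡ true
  iter-mono′ ≤′-refl        on = on
  iter-mono′ (≤′-step t≤t′) on rewrite iter-mono′ t≤t′ on = refl

  iter-mono : ∀ {k S t t′ x} → t ≤ t′ → iter G k S t x ≡ true → iter G k S t′ x ≡ true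
  iter-mono = iter-mono′ ∘ ≤⇒≤′

  Eventually : ℕ → VSet G → V → Set
  Eventually k S x = ∃ λ t → iter G k S t x ≡ true

  spread : ∀ {S x y z} → y ∈ vertices → z ∈ vertices → y ≢ z →
           adj x y ≡ true → adj x z ≡ true →
           Eventually 2 S y → Eventually 2 S z → Eventually 2 S x
  spread {S} {x} y∈ z∈ y≢z xy xz (t₁ , y-on) (t₂ , z-on) =
    suc t , trans (cong (iter G 2 S t x ∨_) (Equivalence.to T-≡ (≤⇒≤ᵇ two-colored))) (∨-zeroʳ _)
    where
      t = t₁ ⊔ t₂
      two-colored : 2 ≤ nbrsIn G (iter G 2 S t) x
      two-colored = countᵇ-≥2 y∈ z∈ y≢z
        (cong₂ _∧_ xy (iter-mono (m≤m⊔n t₁ t₂) y-on))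
        (cong₂ _∧_ xz (iter-mono (m≤n⊔m t₁ t₂) z-on))

  eventually-converts : ∀ {k S} → (∀ x → x ∈ vertices) → (∀ x → Eventually k S x) →
                        IsConversionSet G k S
  eventually-converts {k} {S} complete ev =
    proj₁ (uniform vertices) , λ x → All.lookup (proj₂ (uniform vertices)) (complete x)
    where
      uniform : ∀ xs → ∃ λ t → All (λ x → iter G k S t x ≡ true) xs
      uniform []       = 0 , []
      uniform (x ∷ xs) with ev x | uniform xs
      ... | t , x-on | t′ , xs-on =
        t ⊔ t′ , iter-mono (m≤m⊔n t t′) x-on ∷ All.map (iter-mono (m≤n⊔m t t′)) xs-on

  record Shield (S : VSet G) (U : V → Set) : Set where
    field
      seed-free   : ∀ {x} → U x → S x ≡ false
      single-exit : ∀ {x} → U x → ∃ λ y₀ → ∀ {y} → adj x y ≡ true → ¬ U y → y ≡ y₀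

  module _ (distinct : Unique vertices) {S U} (shield : Shield S U) where
    open Shield shield

    shielded-stay-uncolored : ∀ t {x} → U x → iter G 2 S t x ≡ false
    shielded-stay-uncolored zero    ux = seed-free ux
    shielded-stay-uncolored (suc t) {x} ux
      rewrite shielded-stay-uncolored t ux = below-threshold (countᵇ-≤1 distinct same-exit)
      where
        y₀ = proj₁ (single-exit ux)
        colored-exit : ∀ {y} → (adj x y ∧ iter G 2 S t y) ≡ true → y ≡ y₀
        colored-exit e = proj₂ (single-exit ux) (∧-conicalˡ _ _ e)
          λ uy → contradiction (trans (sym (∧-conicalʳ _ _ e)) (shielded-stay-uncolored t uy)) λ ()
        same-exit : ∀ {y z} → (adj x y ∧ iter G 2 S t y) ≡ true → (adj x z ∧ iter G 2 S t z) ≡ true →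
                    y ≡ z
        same-exit ey ez = trans (colored-exit ey) (sym (colored-exit ez))
        below-threshold : ∀ {c} → c ≤ 1 → (2 ≤ᵇ c) ≡ false
        below-threshold z≤n       = refl
        below-threshold (s≤s z≤n) = refl

    shield-blocks : ∀ {x} → U x → ¬ IsConversionSet G 2 S
    shield-blocks ux (t , all-on) =
      contradiction (trans (sym (all-on _)) (shielded-stay-uncolored t ux)) λ ()

-- The cycle on Fin (suc m)

data Position {m : ℕ} : Fin (suc m) → Set where
  last  : Position (fromℕ m)
  inner : ∀ j → Position (inject₁ j)

position : ∀ {m} (i : Fin (suc m)) → Position i
position {zero}  zero    = last
position {suc m} zero    = inner zero
position {suc m} (suc i) with position i
... | last    = last
... | inner j = inner (suc j)

module Cycle (m : ℕ) where

  next : Fin (suc m) → Fin (suc m)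
  next i = fromℕ< (m%n<n (suc (toℕ i)) (suc m))

  prev : Fin (suc m) → Fin (suc m)
  prev zero    = fromℕ m
  prev (suc j) = inject₁ j

  toℕ-next : ∀ i → toℕ (next i) ≡ suc (toℕ i) % suc m
  toℕ-next i = toℕ-fromℕ< _

  inner-or-last : ∀ i → toℕ i < m ⊎ toℕ i ≡ m
  inner-or-last i = m≤n⇒m<n∨m≡n (≤-pred (toℕ<n i))

  toℕ-next-inner : ∀ {i} → toℕ i < m → toℕ (next i) ≡ suc (toℕ i)
  toℕ-next-inner {i} i<m = trans (toℕ-next i) (m<n⇒m%n≡m (s≤s i<m))

  next-last : ∀ {i} → toℕ i ≡ m → next i ≡ zero
  next-last {i} i≡m = toℕ-injective (begin
    toℕ (next i)         ≡⟨ toℕ-next i ⟩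
    suc (toℕ i) % suc m  ≡⟨ cong (λ k → suc k % suc m) i≡m ⟩
    suc m % suc m        ≡⟨ n%n≡0 (suc m) ⟩
    0                    ∎)
    where open ≡-Reasoning

  next-inject₁ : ∀ j → next (inject₁ j) ≡ suc j
  next-inject₁ j = toℕ-injective (begin
    toℕ (next (inject₁ j))  ≡⟨ toℕ-next-inner (subst (_< m) (sym (toℕ-inject₁ j)) (toℕ<n j)) ⟩
    suc (toℕ (inject₁ j))   ≡⟨ cong suc (toℕ-inject₁ j) ⟩
    suc (toℕ j)             ∎)
    where open ≡-Reasoning

  next-prev : ∀ i → next (prev i) ≡ i
  next-prev zero    = next-last (toℕ-fromℕ m)
  next-prev (suc j) = next-inject₁ j

  prev-next : ∀ i → prev (next i) ≡ i
  prev-next i with position i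
  ... | last    rewrite next-last (toℕ-fromℕ m) = refl
  ... | inner j rewrite next-inject₁ j = refl

  ∑-next : ∀ (f : Fin (suc m) → ℕ) → ∑[ i < suc m ] f (next i) ≡ ∑[ i < suc m ] f i
  ∑-next f = sym (∑-permute f (permutation next prev next-prev prev-next))

  ∑-fold-next : ∀ t (f : Fin (suc m) → ℕ) → ∑[ i < suc m ] f (fold i next t) ≡ ∑[ i < suc m ] f i
  ∑-fold-next zero    f = refl
  ∑-fold-next (suc t) f = trans (∑-fold-next t (f ∘ next)) (∑-next f)

  next∘next≢id : 2 ≤ m → ∀ i → next (next i) ≢ i
  next∘next≢id 2≤m i loop with inner-or-last i
  ... | inj₂ i≡m = <⇒≢ 2≤m (begin
    1                     ≡⟨ sym (toℕ-next-inner (≤-trans z<s 2≤m)) ⟩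
    toℕ (next zero)       ≡⟨ cong (toℕ ∘ next) (sym (next-last i≡m)) ⟩
    toℕ (next (next i))   ≡⟨ cong toℕ loop ⟩
    toℕ i                 ≡⟨ i≡m ⟩
    m                     ∎)
    where open ≡-Reasoning
  ... | inj₁ i<m with m≤n⇒m<n∨m≡n i<m
  ...   | inj₂ 1+i≡m = <⇒≢ 2≤m (begin
    1            ≡⟨ cong suc (sym (cong toℕ (trans (sym loop) (next-last next-i≡m)))) ⟩
    suc (toℕ i)  ≡⟨ 1+i≡m ⟩
    m            ∎)
    where
      open ≡-Reasoning
      next-i≡m = trans (toℕ-next-inner i<m) 1+i≡m
  ...   | inj₁ 1+i<m = <⇒≢ (m<n⇒m<1+n (n<1+n (toℕ i))) (begin
    toℕ i                      ≡⟨ cong toℕ (sym loop) ⟩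
    toℕ (next (next i))        ≡⟨ toℕ-next-inner (subst (_< m) (sym (toℕ-next-inner i<m)) 1+i<m) ⟩
    suc (toℕ (next i))         ≡⟨ cong suc (toℕ-next-inner i<m) ⟩
    suc (suc (toℕ i))          ∎)
    where open ≡-Reasoning

  next≢prev : 2 ≤ m → ∀ i → next i ≢ prev i
  next≢prev 2≤m i e = next∘next≢id 2≤m i (trans (cong next e) (next-prev i))

  cycAdj-next : ∀ i → cycAdj i (next i) ≡ true
  cycAdj-next i rewrite ≡⇒≡ᵇ-true (sym (toℕ-next i)) = refl

  cycAdj-prev : ∀ i → cycAdj i (prev i) ≡ true
  cycAdj-prev i rewrite ≡⇒≡ᵇ-true (trans (sym (toℕ-next (prev i))) (cong toℕ (next-prev i))) = ∨-zeroʳ _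

  cycAdj-neighbour : ∀ {i j} → cycAdj i j ≡ true → j ≡ next i ⊎ j ≡ prev i
  cycAdj-neighbour {i} {j} e with suc (toℕ i) % suc m ≡ᵇ toℕ j in forward
  ... | true  = inj₁ (toℕ-injective (trans (sym (≡ᵇ-true⇒≡ forward)) (sym (toℕ-next i))))
  ... | false = inj₂ (trans (sym (prev-next j))
                            (cong prev (toℕ-injective (trans (toℕ-next j) (≡ᵇ-true⇒≡ e)))))

-- The double corona

module Corona (m p : ℕ) where
  open Cycle m public

  G : FinGraph
  G = DoubleCorona (suc m) p

  Vertex : Set
  Vertex = DCVertex (suc m) p

  open Process G public

  infix 4 _∼_
  data _∼_ : Vertex → Vertex → Set where
    v-next : ∀ {k} → v k ∼ v (next k)
    v-prev : ∀ {k} → v k ∼ v (prev k)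
    w-next : ∀ {k} → w k ∼ w (next k)
    w-prev : ∀ {k} → w k ∼ w (prev k)
    v-u    : ∀ {k j} → v k ∼ u k j
    w-u    : ∀ {k j} → w k ∼ u k j
    u-v    : ∀ {k j} → u k j ∼ v k
    u-w    : ∀ {k j} → u k j ∼ w k
    u-u    : ∀ {k j j′} → j ≢ j′ → u k j ∼ u k j′

  adj⇒∼ : ∀ {x y} → dcAdj x y ≡ true → x ∼ y
  adj⇒∼ {v _} {v _} e with cycAdj-neighbour e
  ... | inj₁ refl = v-next
  ... | inj₂ refl = v-prev
  adj⇒∼ {w _} {w _} e with cycAdj-neighbour e
  ... | inj₁ refl = w-next
  ... | inj₂ refl = w-prev
  adj⇒∼ {v k} {u l _} e with ==⇒≡ {i = k} {l} e
  ... | refl = v-u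
  adj⇒∼ {w k} {u l _} e with ==⇒≡ {i = k} {l} e
  ... | refl = w-u
  adj⇒∼ {u k _} {v l} e with ==⇒≡ {i = k} {l} e
  ... | refl = u-v
  adj⇒∼ {u k _} {w l} e with ==⇒≡ {i = k} {l} e
  ... | refl = u-w
  adj⇒∼ {u k _} {u l _} e with ==⇒≡ {i = k} {l} (∧-conicalˡ _ _ e)
  ... | refl = u-u λ j≡j′ →
    contradiction (trans (sym (cong not (≡⇒== j≡j′))) (∧-conicalʳ _ _ e)) λ ()

  ∼⇒adj : ∀ {x y} → x ∼ y → dcAdj x y ≡ true
  ∼⇒adj (v-next {k}) = cycAdj-next k
  ∼⇒adj (v-prev {k}) = cycAdj-prev k
  ∼⇒adj (w-next {k}) = cycAdj-next k
  ∼⇒adj (w-prev {k}) = cycAdj-prev k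
  ∼⇒adj (v-u {k}) = ≡⇒== {i = k} refl
  ∼⇒adj (w-u {k}) = ≡⇒== {i = k} refl
  ∼⇒adj (u-v {k}) = ≡⇒== {i = k} refl
  ∼⇒adj (u-w {k}) = ≡⇒== {i = k} refl
  ∼⇒adj (u-u {k} j≢j′) rewrite ≡⇒== {i = k} refl = cong not (¬-not (j≢j′ ∘ ==⇒≡))

  vertices-complete : ∀ x → x ∈ dcVertices (suc m) p
  vertices-complete (v k)   = ∈-++⁺ˡ (∈-map⁺ v (∈-allFin k))
  vertices-complete (w k)   = ∈-++⁺ʳ (map v (allFin (suc m))) (∈-++⁺ˡ (∈-map⁺ w (∈-allFin k)))
  vertices-complete (u k j) = ∈-++⁺ʳ (map v (allFin (suc m))) (∈-++⁺ʳ (map w (allFin (suc m)))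
    (∈-concat⁺′ (∈-map⁺ (u k) (∈-allFin j)) (∈-map⁺ (λ l → map (u l) (allFin p)) (∈-allFin k))))

  vertices-unique : Unique (dcVertices (suc m) p)
  vertices-unique rewrite concatMap-map≡cartesianProductWith u (allFin (suc m)) (allFin p) =
    ++⁺ (map⁺ (λ { refl → refl }) (allFin⁺ (suc m)))
        (++⁺ (map⁺ (λ { refl → refl }) (allFin⁺ (suc m)))
             (cartesianProductWith⁺ u (λ { refl → refl , refl }) (allFin⁺ (suc m)) (allFin⁺ p))
             ws-cliques-disjoint)
        vs-rest-disjoint
    where
      vs = map v (allFin (suc m))
      ws = map w (allFin (suc m))
      cliques = cartesianProductWith u (allFin (suc m)) (allFin p)
      ∉-cliques : ∀ {x} → (∀ k j → x ≢ u k j) → ¬ x ∈ cliques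
      ∉-cliques x≢u x∈ with ∈-cartesianProductWith⁻ u (allFin (suc m)) (allFin p) x∈
      ... | k , j , _ , _ , x≡u = x≢u k j x≡u
      ws-cliques-disjoint : Disjoint ws cliques
      ws-cliques-disjoint (x∈ws , x∈us) with ∈-map⁻ w x∈ws
      ... | _ , _ , refl = ∉-cliques (λ _ _ ()) x∈us
      vs-rest-disjoint : Disjoint vs (ws ++ cliques)
      vs-rest-disjoint (x∈vs , x∈rest) with ∈-map⁻ v x∈vs
      ... | _ , _ , refl with ∈-++⁻ ws x∈rest
      ...   | inj₂ x∈us = ∉-cliques (λ _ _ ()) x∈us
      ...   | inj₁ x∈ws with ∈-map⁻ w x∈ws
      ...     | _ , _ , ()

  v-injective : ∀ {k l : Fin (suc m)} → v k ≡ v {p = p} l → k ≡ l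
  v-injective refl = refl

  w-injective : ∀ {k l : Fin (suc m)} → w k ≡ w {p = p} l → k ≡ l
  w-injective refl = refl

  gadget : Fin (suc m) → List Vertex
  gadget k = v k ∷ w k ∷ map (u k) (allFin p)

  sum-over-gadgets : ∀ (f : Vertex → ℕ) →
                     sum (map f (dcVertices (suc m) p)) ≡ ∑[ k < suc m ] sum (map f (gadget k))
  sum-over-gadgets f = begin
    sum (map f (vs ++ ws ++ cliques))
      ≡⟨ sum-map-++ f vs (ws ++ cliques) ⟩
    sum (map f vs) + sum (map f (ws ++ cliques))
      ≡⟨ cong (sum (map f vs) +_) (sum-map-++ f ws cliques) ⟩
    sum (map f vs) + (sum (map f ws) + sum (map f cliques))
      ≡⟨ cong₂ _+_ (sum-map-map-allFin f v)
                   (cong₂ _+_ (sum-map-map-allFin f w) (sum-map-concatMap f clique id)) ⟩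
    ∑[ k < suc m ] f (v k) + (∑[ k < suc m ] f (w k) + ∑[ k < suc m ] clique-sum k)
      ≡⟨ cong (∑[ k < suc m ] f (v k) +_) (∑-distrib-+ (f ∘ w) clique-sum) ⟨
    ∑[ k < suc m ] f (v k) + ∑[ k < suc m ] (f (w k) + clique-sum k)
      ≡⟨ ∑-distrib-+ (f ∘ v) (λ k → f (w k) + clique-sum k) ⟨
    ∑[ k < suc m ] sum (map f (gadget k)) ∎
    where
      open ≡-Reasoning
      vs = map v (allFin (suc m))
      ws = map w (allFin (suc m))
      clique = λ k → map (u k) (allFin p)
      cliques = concatMap clique (allFin (suc m))
      clique-sum = λ k → sum (map f (clique k))

  spread-∼ : ∀ {S x y z} → x ∼ y → x ∼ z → y ≢ z →
             Eventually 2 S y → Eventually 2 S z → Eventually 2 S x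
  spread-∼ xy xz y≢z = spread (vertices-complete _) (vertices-complete _) y≢z (∼⇒adj xy) (∼⇒adj xz)

  shield : ∀ {S U} → (∀ {x} → U x → S x ≡ false) →
           (∀ {x} → U x → ∃ λ y₀ → ∀ {y} → x ∼ y → ¬ U y → y ≡ y₀) → Shield S U
  shield seed-free exits = record
    { seed-free   = seed-free
    ; single-exit = λ ux → proj₁ (exits ux) , λ xy → proj₂ (exits ux) (adj⇒∼ xy)
    }

  module Blocking (S : Vertex → Bool) where

    CliqueUnseeded : Fin (suc m) → Set
    CliqueUnseeded k = ∀ j → S (u k j) ≡ false

    Unseeded : Fin (suc m) → Set
    Unseeded k = S (v k) ≡ false × S (w k) ≡ false × CliqueUnseeded k

    Sparse : Fin (suc m) → Set
    Sparse k = S (v k) ≡ false × S (w k) ≡ false × ∃ λ y₀ → ∀ j → S (u k j) ≡ true → u k j ≡ y₀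

    unseeded⇒sparse : ∀ {k} → Unseeded k → Sparse k
    unseeded⇒sparse {k} (vk , wk , uk) =
      vk , wk , v k , λ j seeded → contradiction (trans (sym (uk j)) seeded) λ ()

    w-pair-blocks : ∀ k → S (w k) ≡ false → S (w (next k)) ≡ false →
                    CliqueUnseeded k → CliqueUnseeded (next k) → ¬ IsConversionSet G 2 S
    w-pair-blocks k wk wk′ uk uk′ =
      shield-blocks vertices-unique (shield seed-free exits) {w k} (inj₁ refl)
      where
        U : Vertex → Set
        U (v _)   = ⊥
        U (w l)   = l ≡ k ⊎ l ≡ next k
        U (u l _) = l ≡ k ⊎ l ≡ next k
        seed-free : ∀ {x} → U x → S x ≡ false
        seed-free {w _}   (inj₁ refl) = wk
        seed-free {w _}   (inj₂ refl) = wk′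
        seed-free {u _ j} (inj₁ refl) = uk j
        seed-free {u _ j} (inj₂ refl) = uk′ j
        exits : ∀ {x} → U x → ∃ λ y₀ → ∀ {y} → x ∼ y → ¬ U y → y ≡ y₀
        exits {w _} (inj₁ refl) = w (prev k) , λ
          { w-next out → ⊥-elim (out (inj₂ refl))
          ; w-prev _ → refl
          ; w-u out → ⊥-elim (out (inj₁ refl))
          }
        exits {w _} (inj₂ refl) = w (next (next k)) , λ
          { w-next _ → refl
          ; w-prev out → ⊥-elim (out (inj₁ (prev-next k)))
          ; w-u out → ⊥-elim (out (inj₂ refl))
          }
        exits {u l _} ul = v l , λ
          { u-v _ → refl
          ; u-w out → ⊥-elim (out ul)
          ; (u-u _) out → ⊥-elim (out ul)
          }

    v-pair-blocks : ∀ k → S (v k) ≡ false → S (v (next k)) ≡ false →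
                    CliqueUnseeded k → CliqueUnseeded (next k) → ¬ IsConversionSet G 2 S
    v-pair-blocks k vk vk′ uk uk′ =
      shield-blocks vertices-unique (shield seed-free exits) {v k} (inj₁ refl)
      where
        U : Vertex → Set
        U (v l)   = l ≡ k ⊎ l ≡ next k
        U (w _)   = ⊥
        U (u l _) = l ≡ k ⊎ l ≡ next k
        seed-free : ∀ {x} → U x → S x ≡ false
        seed-free {v _}   (inj₁ refl) = vk
        seed-free {v _}   (inj₂ refl) = vk′
        seed-free {u _ j} (inj₁ refl) = uk j
        seed-free {u _ j} (inj₂ refl) = uk′ j
        exits : ∀ {x} → U x → ∃ λ y₀ → ∀ {y} → x ∼ y → ¬ U y → y ≡ y₀
        exits {v _} (inj₁ refl) = v (prev k) , λ
          { v-next out → ⊥-elim (out (inj₂ refl))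
          ; v-prev _ → refl
          ; v-u out → ⊥-elim (out (inj₁ refl))
          }
        exits {v _} (inj₂ refl) = v (next (next k)) , λ
          { v-next _ → refl
          ; v-prev out → ⊥-elim (out (inj₁ (prev-next k)))
          ; v-u out → ⊥-elim (out (inj₂ refl))
          }
        exits {u l _} ul = w l , λ
          { u-w _ → refl
          ; u-v out → ⊥-elim (out ul)
          ; (u-u _) out → ⊥-elim (out ul)
          }

    Run : (Fin (suc m) → Set) → Set
    Run R = ∀ {k} → R k → Sparse k ×
      (R (next k) × R (prev k) ⊎ CliqueUnseeded k × (R (next k) ⊎ R (prev k)))

    -- An interior rim's only exit is the clique seed; an end rim's only exit is its cycle
    -- neighbour outside the run.
    run-blocks : ∀ {R k} → Run R → R k → ¬ IsConversionSet G 2 S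
    run-blocks {R} run rk = shield-blocks vertices-unique (shield seed-free exits) {v _} rk
      where
        U : Vertex → Set
        U (v k)   = R k
        U (w k)   = R k
        U (u k j) = R k × S (u k j) ≡ false
        seed-free : ∀ {x} → U x → S x ≡ false
        seed-free {v _} rk = proj₁ (proj₁ (run rk))
        seed-free {w _} rk = proj₁ (proj₂ (proj₁ (run rk)))
        seed-free {u _ _} (_ , ukj) = ukj
        seeded : ∀ {k j} → R k → ¬ U (u k j) → S (u k j) ≡ true
        seeded rk out = ¬-not (λ ukj → out (rk , ukj))
        exits : ∀ {x} → U x → ∃ λ y₀ → ∀ {y} → x ∼ y → ¬ U y → y ≡ y₀
        exits {v k} rk with run rk
        ... | (_ , _ , y₀ , single) , inj₁ (r-next , r-prev) = y₀ , λ
          { v-next out → ⊥-elim (out r-next)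
          ; v-prev out → ⊥-elim (out r-prev)
          ; v-u out → single _ (seeded rk out)
          }
        ... | _ , inj₂ (clear , inj₁ r-next) = v (prev k) , λ
          { v-next out → ⊥-elim (out r-next)
          ; v-prev _ → refl
          ; v-u out → ⊥-elim (out (rk , clear _))
          }
        ... | _ , inj₂ (clear , inj₂ r-prev) = v (next k) , λ
          { v-next _ → refl
          ; v-prev out → ⊥-elim (out r-prev)
          ; v-u out → ⊥-elim (out (rk , clear _))
          }
        exits {w k} rk with run rk
        ... | (_ , _ , y₀ , single) , inj₁ (r-next , r-prev) = y₀ , λ
          { w-next out → ⊥-elim (out r-next)
          ; w-prev out → ⊥-elim (out r-prev)
          ; w-u out → single _ (seeded rk out)
          }
        ... | _ , inj₂ (clear , inj₁ r-next) = w (prev k) , λ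
          { w-next out → ⊥-elim (out r-next)
          ; w-prev _ → refl
          ; w-u out → ⊥-elim (out (rk , clear _))
          }
        ... | _ , inj₂ (clear , inj₂ r-prev) = w (next k) , λ
          { w-next _ → refl
          ; w-prev out → ⊥-elim (out r-prev)
          ; w-u out → ⊥-elim (out (rk , clear _))
          }
        exits {u k _} (rk , _) with run rk
        ... | (_ , _ , y₀ , single) , _ = y₀ , λ
          { u-v out → ⊥-elim (out rk)
          ; u-w out → ⊥-elim (out rk)
          ; (u-u _) out → single _ (seeded rk out)
          }

    gap-blocks : ∀ {i} L → Unseeded i → (∀ (t : Fin L) → Sparse (fold i next (suc (toℕ t)))) →
                 Unseeded (fold i next (suc L)) → ¬ IsConversionSet G 2 S
    gap-blocks {i} L first interior final = run-blocks {R} run (0 , z≤n , refl)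
      where
        R : Fin (suc m) → Set
        R k = ∃ λ t → t ≤ suc L × k ≡ fold i next t
        back : ∀ {t} → t ≤ suc L → R (prev (next (fold i next t)))
        back {t} t≤ = t , t≤ , prev-next _
        run : Run R
        run (zero , _ , refl) =
          unseeded⇒sparse first , inj₂ (proj₂ (proj₂ first) , inj₁ (1 , s≤s z≤n , refl))
        run (suc t , t<2+L , refl) with m≤n⇒m<n∨m≡n (≤-pred t<2+L)
        ... | inj₁ t<L  = subst (Sparse ∘ fold i next ∘ suc) (toℕ-fromℕ< t<L) (interior (fromℕ< t<L)) ,
                          inj₁ ((suc (suc t) , s≤s t<L , refl) , back (m≤n⇒m≤1+n (<⇒≤ t<L)))
        ... | inj₂ refl = unseeded⇒sparse final , inj₂ (proj₂ (proj₂ final) , inj₂ (back (n≤1+n t)))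

-- Lower bound

window-bound : ∀ a b c d →
  (a ≡ 0 → b ≡ 0 → ⊥) → (b ≡ 0 → c ≡ 0 → ⊥) → (c ≡ 0 → d ≡ 0 → ⊥) →
  (a ≡ 0 → b ≡ 1 → c ≡ 0 → ⊥) → (b ≡ 0 → c ≡ 1 → d ≡ 0 → ⊥) →
  (a ≡ 0 → b ≡ 1 → c ≡ 1 → d ≡ 0 → ⊥) →
  3 ≤ sum (a ∷ b ∷ c ∷ d ∷ [])
window-bound 0 0 _ _ ab _ _ _ _ _ = ⊥-elim (ab refl refl)
window-bound 0 1 0 _ _ _ _ abc _ _ = ⊥-elim (abc refl refl refl)
window-bound 0 1 1 0 _ _ _ _ _ abcd = ⊥-elim (abcd refl refl refl refl)
window-bound a@0 b@1 c@1 d@(suc _) _ _ _ _ _ _ =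
  sum-mono-≤ {ys = a ∷ b ∷ c ∷ d ∷ []} (z≤n ∷ z<s ∷ z<s ∷ z<s ∷ [])
window-bound a@0 b@1 c@(suc (suc _)) d _ _ _ _ _ _ =
  sum-mono-≤ {ys = a ∷ b ∷ c ∷ d ∷ []} (z≤n ∷ z<s ∷ s<s z<s ∷ z≤n ∷ [])
window-bound 0 (suc (suc _)) 0 0 _ _ cd _ _ _ = ⊥-elim (cd refl refl)
window-bound a@0 b@(suc (suc _)) c@0 d@(suc _) _ _ _ _ _ _ =
  sum-mono-≤ {ys = a ∷ b ∷ c ∷ d ∷ []} (z≤n ∷ s<s z<s ∷ z≤n ∷ z<s ∷ [])
window-bound a@0 b@(suc (suc _)) c@(suc _) d _ _ _ _ _ _ =
  sum-mono-≤ {ys = a ∷ b ∷ c ∷ d ∷ []} (z≤n ∷ s<s z<s ∷ z<s ∷ z≤n ∷ [])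
window-bound (suc _) 0 0 _ _ bc _ _ _ _ = ⊥-elim (bc refl refl)
window-bound (suc _) 0 1 0 _ _ _ _ bcd _ = ⊥-elim (bcd refl refl refl)
window-bound a@(suc _) b@0 c@1 d@(suc _) _ _ _ _ _ _ =
  sum-mono-≤ {ys = a ∷ b ∷ c ∷ d ∷ []} (z<s ∷ z≤n ∷ z<s ∷ z<s ∷ [])
window-bound a@(suc _) b@0 c@(suc (suc _)) d _ _ _ _ _ _ =
  sum-mono-≤ {ys = a ∷ b ∷ c ∷ d ∷ []} (z<s ∷ z≤n ∷ s<s z<s ∷ z≤n ∷ [])
window-bound (suc _) (suc _) 0 0 _ _ cd _ _ _ = ⊥-elim (cd refl refl)
window-bound a@(suc _) b@(suc _) c@0 d@(suc _) _ _ _ _ _ _ =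
  sum-mono-≤ {ys = a ∷ b ∷ c ∷ d ∷ []} (z<s ∷ z<s ∷ z≤n ∷ z<s ∷ [])
window-bound a@(suc _) b@(suc _) c@(suc _) d _ _ _ _ _ _ =
  sum-mono-≤ {ys = a ∷ b ∷ c ∷ d ∷ []} (z<s ∷ z<s ∷ z<s ∷ z≤n ∷ [])

module LowerBound (m p : ℕ) (S : DCVertex (suc m) p → Bool) where
  open Corona m p
  open Blocking S

  load : Fin (suc m) → ℕ
  load k = countᵇ S (gadget k)

  ∈-gadget : ∀ {k} j → u k j ∈ gadget k
  ∈-gadget {k} j = there (there (∈-map⁺ (u k) (∈-allFin j)))

  load≡0⇒unseeded : ∀ {k} → load k ≡ 0 → Unseeded k
  load≡0⇒unseeded {k} none = unseeded (here refl) , unseeded (there (here refl)) , unseeded ∘ ∈-gadget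
    where
      unseeded : ∀ {x} → x ∈ gadget k → S x ≡ false
      unseeded = countᵇ-≡0 {P = S} none

  only-seed : ∀ {k x y} → load k ≤ 1 → x ∈ gadget k → y ∈ gadget k → x ≢ y →
              S x ≡ true → S y ≡ false
  only-seed ≤1 x∈ y∈ x≢y Sx = ¬-not λ Sy → 1+n≰n (≤-trans (countᵇ-≥2 {P = S} x∈ y∈ x≢y Sx Sy) ≤1)

  load≤1-cases : ∀ {k} → load k ≤ 1 →
    (S (w k) ≡ false × CliqueUnseeded k) ⊎ (S (v k) ≡ false × CliqueUnseeded k) ⊎ Sparse k
  load≤1-cases {k} ≤1 with S (v k) Bool.≟ true
  ... | yes vk = inj₁ (only-seed ≤1 (here refl) (there (here refl)) (λ ()) vk ,
                       λ j → only-seed ≤1 (here refl) (∈-gadget j) (λ ()) vk)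
  ... | no ¬vk with S (w k) Bool.≟ true
  ...   | yes wk = inj₂ (inj₁ (¬-not ¬vk ,
                                 λ j → only-seed ≤1 (there (here refl)) (∈-gadget j) (λ ()) wk))
  ...   | no ¬wk = inj₂ (inj₂ (¬-not ¬vk , ¬-not ¬wk , single-clique-seed))
    where
      single-clique-seed : ∃ λ y₀ → ∀ j → S (u k j) ≡ true → u k j ≡ y₀
      single-clique-seed with any? (λ j → S (u k j) Bool.≟ true)
      ... | no  none       = v k , λ j seeded → ⊥-elim (none (j , seeded))
      ... | yes (j₀ , s₀) = u k j₀ , λ j seeded → same-vertex j seeded
        where
          same-vertex : ∀ j → S (u k j) ≡ true → u k j ≡ u k j₀
          same-vertex j seeded with j Fin.≟ j₀
          ... | yes refl = refl
          ... | no  j≢j₀ = contradiction (trans (sym seeded) unseeded) λ ()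
            where
              unseeded = only-seed ≤1 (∈-gadget j₀) (∈-gadget j) (λ { refl → j≢j₀ refl }) s₀

  module _ (conv : IsConversionSet G 2 S) where

    sparse-after-unseeded : ∀ {k} → load k ≡ 0 → load (next k) ≡ 1 → Sparse (next k)
    sparse-after-unseeded {k} none one with load≡0⇒unseeded none | load≤1-cases (≤-reflexive one)
    ... | vk , wk , uk | inj₁ (wk′ , uk′)         = ⊥-elim (w-pair-blocks k wk wk′ uk uk′ conv)
    ... | vk , wk , uk | inj₂ (inj₁ (vk′ , uk′))  = ⊥-elim (v-pair-blocks k vk vk′ uk uk′ conv)
    ... | _            | inj₂ (inj₂ sparse)       = sparse

    sparse-before-unseeded : ∀ {k} → load (next k) ≡ 0 → load k ≡ 1 → Sparse k
    sparse-before-unseeded {k} none one with load≡0⇒unseeded none | load≤1-cases (≤-reflexive one)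
    ... | vk′ , wk′ , uk′ | inj₁ (wk , uk)         = ⊥-elim (w-pair-blocks k wk wk′ uk uk′ conv)
    ... | vk′ , wk′ , uk′ | inj₂ (inj₁ (vk , uk))  = ⊥-elim (v-pair-blocks k vk vk′ uk uk′ conv)
    ... | _               | inj₂ (inj₂ sparse)     = sparse

    window : ∀ k → 3 ≤ ∑[ t < 4 ] load (fold k next (toℕ t))
    window k = window-bound _ _ _ _ (no-gap₀ k) (no-gap₀ (next k)) (no-gap₀ (next (next k)))
                                    (no-gap₁ k) (no-gap₁ (next k)) (no-gap₂ k)
      where
        no-gap₀ : ∀ l → load l ≡ 0 → load (next l) ≡ 0 → ⊥
        no-gap₀ l a b = gap-blocks 0 (load≡0⇒unseeded a) (λ ()) (load≡0⇒unseeded b) conv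
        no-gap₁ : ∀ l → load l ≡ 0 → load (next l) ≡ 1 → load (next (next l)) ≡ 0 → ⊥
        no-gap₁ l a b c = gap-blocks 1 (load≡0⇒unseeded a)
          (λ { zero → sparse-after-unseeded a b }) (load≡0⇒unseeded c) conv
        no-gap₂ : ∀ l → load l ≡ 0 → load (next l) ≡ 1 → load (next (next l)) ≡ 1 →
                  load (next (next (next l))) ≡ 0 → ⊥
        no-gap₂ l a b c d = gap-blocks 2 (load≡0⇒unseeded a)
          (λ { zero → sparse-after-unseeded a b ; (suc zero) → sparse-before-unseeded d c })
          (load≡0⇒unseeded d) conv

    three-quarters-bound : 3 * suc m ≤ 4 * size G S
    three-quarters-bound = begin
      3 * suc m                                            ≡⟨ *-comm 3 (suc m) ⟩
      suc m * 3                                            ≡⟨ ∑-const (suc m) 3 ⟨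
      ∑[ k < suc m ] 3                                     ≤⟨ ∑-mono-≤ window ⟩
      ∑[ k < suc m ] ∑[ t < 4 ] shifted k t                ≡⟨ ∑-comm {suc m} {4} shifted ⟩
      ∑[ t < 4 ] ∑[ k < suc m ] shifted k t                ≡⟨ sum-cong-≗ {4} (λ t → ∑-fold-next (toℕ t) load) ⟩
      ∑[ t < 4 ] ∑[ k < suc m ] load k                     ≡⟨ ∑-const 4 (∑[ k < suc m ] load k) ⟩
      4 * ∑[ k < suc m ] load k                            ≡⟨ cong (4 *_) (sum-over-gadgets (𝟙 ∘ S)) ⟨
      4 * size G S                                         ∎
      where
        open ≤-Reasoning
        shifted : Fin (suc m) → Fin 4 → ℕ
        shifted k t = load (fold k next (toℕ t))

-- Upper bound

data Kind : Set where
  rim clique empty : Kind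

motif : ℕ → Kind
motif 0 = rim
motif 1 = clique
motif 2 = empty
motif 3 = clique
motif (suc (suc (suc (suc k)))) = motif k

motif-after-nonclique : ∀ k → motif k ≢ clique → motif (suc k) ≡ clique
motif-after-nonclique 0 _  = refl
motif-after-nonclique 1 ¬c = contradiction refl ¬c
motif-after-nonclique 2 _  = refl
motif-after-nonclique 3 ¬c = contradiction refl ¬c
motif-after-nonclique (suc (suc (suc (suc k)))) ¬c = motif-after-nonclique k ¬c

motif-before-nonclique : ∀ k → motif (suc k) ≢ clique → motif k ≡ clique
motif-before-nonclique 0 ¬c = contradiction refl ¬c
motif-before-nonclique 1 _  = refl
motif-before-nonclique 2 ¬c = contradiction refl ¬c
motif-before-nonclique 3 _  = refl
motif-before-nonclique (suc (suc (suc (suc k)))) ¬c = motif-before-nonclique k ¬c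

motif-beside-clique : ∀ k → motif (suc k) ≡ clique → motif (suc (suc k)) ≡ rim ⊎ motif k ≡ rim
motif-beside-clique 0 _ = inj₂ refl
motif-beside-clique 1 ()
motif-beside-clique 2 _ = inj₁ refl
motif-beside-clique 3 ()
motif-beside-clique (suc (suc (suc (suc k)))) c = motif-beside-clique k c

weight : Kind → ℕ
weight rim    = 1
weight clique = 1
weight empty  = 0

motif-weight : ∀ n → ∑[ j < n ] weight (motif (toℕ j)) + suc n / 4 ≡ n
motif-weight 0 = refl
motif-weight 1 = refl
motif-weight 2 = refl
motif-weight 3 = refl
motif-weight (suc (suc (suc (suc n)))) = cong (3 +_) (begin
  rest + (5 + n) / 4      ≡⟨ cong (rest +_) (m/n≡1+[m∸n]/n {5 + n} {4} (s≤s (s≤s (s≤s (s≤s z≤n))))) ⟩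
  rest + suc (suc n / 4)  ≡⟨ +-suc rest (suc n / 4) ⟩
  suc (rest + suc n / 4)  ≡⟨ cong suc (motif-weight n) ⟩
  suc n                   ∎)
  where
    open ≡-Reasoning
    rest = ∑[ j < n ] weight (motif (toℕ j))

isRim : Kind → Bool
isRim rim = true
isRim _   = false

isClique : Kind → Bool
isClique clique = true
isClique _      = false

weight-seeds : ∀ κ → 𝟙 (isRim κ) + (𝟙 (isClique κ) + 0) ≡ weight κ
weight-seeds rim    = refl
weight-seeds clique = refl
weight-seeds empty  = refl

module UpperBound (m p′ : ℕ) (2≤m : 2 ≤ m) where
  open Corona m (suc (suc p′))

  -- The last gadget is clique-seeded so that the motif still fits across the wrap to gadget 0.
  kind : Fin (suc m) → Kind
  kind i = if does (toℕ i ≟ m) then clique else motif (toℕ i)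

  kind-last : ∀ {i} → toℕ i ≡ m → kind i ≡ clique
  kind-last {i} i≡m rewrite dec-true (toℕ i ≟ m) i≡m = refl

  kind-inner : ∀ {i} → toℕ i < m → kind i ≡ motif (toℕ i)
  kind-inner {i} i<m rewrite dec-false (toℕ i ≟ m) (<⇒≢ i<m) = refl

  kind-cases : ∀ i → kind i ≡ clique ⊎ kind i ≡ motif (toℕ i)
  kind-cases i with does (toℕ i ≟ m)
  ... | true  = inj₁ refl
  ... | false = inj₂ refl

  kind-zero : kind zero ≡ rim
  kind-zero = kind-inner (≤-trans z<s 2≤m)

  nonclique-neighbours : ∀ i → kind i ≢ clique → kind (next i) ≡ clique × kind (prev i) ≡ clique
  nonclique-neighbours i ¬c with inner-or-last i
  ... | inj₂ i≡m = contradiction (kind-last i≡m) ¬c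
  ... | inj₁ i<m = after , before i (¬c ∘ trans (kind-inner i<m))
    where
      after : kind (next i) ≡ clique
      after with kind-cases (next i)
      ... | inj₁ c = c
      ... | inj₂ e = trans e (trans (cong motif (toℕ-next-inner i<m))
                                    (motif-after-nonclique (toℕ i) (¬c ∘ trans (kind-inner i<m))))
      before : ∀ l → motif (toℕ l) ≢ clique → kind (prev l) ≡ clique
      before zero    _  = kind-last (toℕ-fromℕ m)
      before (suc j) ¬m with kind-cases (inject₁ j)
      ... | inj₁ c = c
      ... | inj₂ e = trans e (trans (cong motif (toℕ-inject₁ j)) (motif-before-nonclique (toℕ j) ¬m))

  clique-neighbours : ∀ i → kind i ≡ clique →
    kind (next i) ≡ rim ⊎ kind (prev i) ≡ rim ⊎ kind (next i) ≡ clique × kind (next (next i)) ≡ rim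
  clique-neighbours i c with inner-or-last i
  ... | inj₂ i≡m = inj₁ (trans (cong kind (next-last i≡m)) kind-zero)
  clique-neighbours zero    c | inj₁ _   = contradiction (trans (sym kind-zero) c) λ ()
  clique-neighbours (suc j) c | inj₁ i<m
    with motif-beside-clique (toℕ j) (trans (sym (kind-inner i<m)) c)
  ... | inj₂ r = inj₂ (inj₁ (trans (kind-inner j<m) (trans (cong motif (toℕ-inject₁ j)) r)))
    where
      j<m : toℕ (inject₁ j) < m
      j<m = subst (_< m) (sym (toℕ-inject₁ j)) (<-trans (n<1+n (toℕ j)) i<m)
  ... | inj₁ r with m≤n⇒m<n∨m≡n i<m
  ...   | inj₁ 1+i<m = inj₁ (trans (kind-inner next<m) (trans (cong motif (toℕ-next-inner i<m)) r))
    where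
      next<m : toℕ (next (suc j)) < m
      next<m = subst (_< m) (sym (toℕ-next-inner i<m)) 1+i<m
  ...   | inj₂ 1+i≡m = inj₂ (inj₂ (kind-last next≡m , trans (cong kind (next-last next≡m)) kind-zero))
    where
      next≡m : toℕ (next (suc j)) ≡ m
      next≡m = trans (toℕ-next-inner i<m) 1+i≡m

  seed : Vertex → Bool
  seed (v k)           = isRim (kind k)
  seed (w _)           = false
  seed (u k zero)      = isClique (kind k)
  seed (u _ (suc _))   = false

  Colored : Vertex → Set
  Colored = Eventually 2 seed

  rims⇒clique : ∀ {k} → Colored (v k) → Colored (w k) → ∀ j → Colored (u k j)
  rims⇒clique cv cw j = spread-∼ u-v u-w (λ ()) cv cw

  module _ {k} (c : kind k ≡ clique) where

    hub : Colored (u k zero)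
    hub = 0 , cong isClique c

    v-via : ∀ {l} → v k ∼ v l → Colored (v l) → Colored (v k)
    v-via kl cl = spread-∼ kl v-u (λ ()) cl hub

    w-from-v : Colored (v k) → Colored (w k)
    w-from-v cv = spread-∼ w-u w-u (λ ()) hub neighbour
      where
        neighbour : Colored (u k (suc zero))
        neighbour = spread-∼ u-v (u-u λ ()) (λ ()) cv hub

  clique-gadget-v : ∀ i → kind i ≡ clique → Colored (v i)
  clique-gadget-v i c with clique-neighbours i c
  ... | inj₁ r               = v-via c v-next (0 , cong isRim r)
  ... | inj₂ (inj₁ r)        = v-via c v-prev (0 , cong isRim r)
  ... | inj₂ (inj₂ (c′ , r)) = v-via c v-next (v-via c′ v-next (0 , cong isRim r))

  clique-gadget-rims : ∀ {i} → kind i ≡ clique → Colored (v i) × Colored (w i)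
  clique-gadget-rims {i} c = clique-gadget-v i c , w-from-v c (clique-gadget-v i c)

  between-cliques : ∀ i → kind (next i) ≡ clique × kind (prev i) ≡ clique → Colored (v i) × Colored (w i)
  between-cliques i (cn , cp) =
    spread-∼ v-next v-prev (next≢prev 2≤m i ∘ v-injective) (proj₁ next-rims) (proj₁ prev-rims) ,
    spread-∼ w-next w-prev (next≢prev 2≤m i ∘ w-injective) (proj₂ next-rims) (proj₂ prev-rims)
    where
      next-rims = clique-gadget-rims cn
      prev-rims = clique-gadget-rims cp

  rims-colored : ∀ i → Colored (v i) × Colored (w i)
  rims-colored i with kind i in e
  ... | clique = clique-gadget-rims e
  ... | rim    = between-cliques i (nonclique-neighbours i λ c → contradiction (trans (sym e) c) λ ())
  ... | empty  = between-cliques i (nonclique-neighbours i λ c → contradiction (trans (sym e) c) λ ())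

  colored : ∀ x → Colored x
  colored (v i)   = proj₁ (rims-colored i)
  colored (w i)   = proj₂ (rims-colored i)
  colored (u i j) = rims⇒clique (proj₁ (rims-colored i)) (proj₂ (rims-colored i)) j

  seed-converts : IsConversionSet G 2 seed
  seed-converts = eventually-converts vertices-complete colored

  gadget-load : ∀ k → countᵇ seed (gadget k) ≡ weight (kind k)
  gadget-load k = begin
    𝟙 (isRim (kind k)) + (0 + (𝟙 (isClique (kind k)) + countᵇ seed (map (u k) (tabulate suc))))
      ≡⟨ cong (λ z → 𝟙 (isRim (kind k)) + (𝟙 (isClique (kind k)) + z)) unseeded-rest ⟩
    𝟙 (isRim (kind k)) + (𝟙 (isClique (kind k)) + 0)
      ≡⟨ weight-seeds (kind k) ⟩
    weight (kind k) ∎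
    where
      open ≡-Reasoning
      unseeded-rest : countᵇ seed (map (u k) (tabulate suc)) ≡ 0
      unseeded-rest = begin
        countᵇ seed (map (u k) (tabulate suc))  ≡⟨ cong (countᵇ seed) (map-tabulate suc (u k)) ⟩
        countᵇ seed (tabulate (u k ∘ suc))      ≡⟨ sum-map-tabulate (𝟙 ∘ seed) (u k ∘ suc) ⟩
        ∑[ j < suc p′ ] 0                       ≡⟨ ∑-const (suc p′) 0 ⟩
        suc p′ * 0                              ≡⟨ *-zeroʳ (suc p′) ⟩
        0                                       ∎

  seed-size : size G seed ≡ suc m ∸ suc m / 4
  seed-size = begin
    size G seed
      ≡⟨ sum-over-gadgets (𝟙 ∘ seed) ⟩
    ∑[ k < suc m ] countᵇ seed (gadget k)
      ≡⟨ sum-cong-≗ gadget-load ⟩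
    ∑[ k < suc m ] weight (kind k)
      ≡⟨ sum-init-last (weight ∘ kind) ⟩
    ∑[ j < m ] weight (kind (inject₁ j)) + weight (kind (fromℕ m))
      ≡⟨ cong₂ _+_ (sum-cong-≗ inner-weight) (cong weight (kind-last (toℕ-fromℕ m))) ⟩
    motif-seeds + 1
      ≡⟨ +-comm motif-seeds 1 ⟩
    suc motif-seeds
      ≡⟨ m+n∸n≡m (suc motif-seeds) (suc m / 4) ⟨
    suc (motif-seeds + suc m / 4) ∸ suc m / 4
      ≡⟨ cong (λ k → suc k ∸ suc m / 4) (motif-weight m) ⟩
    suc m ∸ suc m / 4 ∎
    where
      open ≡-Reasoning
      motif-seeds = ∑[ j < m ] weight (motif (toℕ j))
      inner-weight : ∀ j → weight (kind (inject₁ j)) ≡ weight (motif (toℕ j))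
      inner-weight j = cong weight (trans (kind-inner (subst (_< m) (sym (toℕ-inject₁ j)) (toℕ<n j)))
                                          (cong motif (toℕ-inject₁ j)))

3n≤4s⇒[3n+3]/4≤s : ∀ {n s} → 3 * n ≤ 4 * s → (3 * n + 3) / 4 ≤ s
3n≤4s⇒[3n+3]/4≤s {n} {s} 3n≤4s = ≤-pred (m<n*o⇒m/o<n (begin-strict
  3 * n + 3      ≤⟨ +-monoˡ-≤ 3 3n≤4s ⟩
  4 * s + 3      ≡⟨ +-comm (4 * s) 3 ⟩
  3 + 4 * s      <⟨ n<1+n (3 + 4 * s) ⟩
  4 + 4 * s      ≡⟨ cong (4 +_) (*-comm 4 s) ⟩
  suc s * 4      ∎))
  where open ≤-Reasoning

[3n+3]/4≡n∸n/4 : ∀ n → (3 * n + 3) / 4 ≡ n ∸ n / 4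
[3n+3]/4≡n∸n/4 0 = refl
[3n+3]/4≡n∸n/4 1 = refl
[3n+3]/4≡n∸n/4 2 = refl
[3n+3]/4≡n∸n/4 3 = refl
[3n+3]/4≡n∸n/4 (suc (suc (suc (suc n)))) = begin
  (3 * (4 + n) + 3) / 4    ≡⟨ cong (λ k → (k + 3) / 4) (*-distribˡ-+ 3 4 n) ⟩
  (12 + 3 * n + 3) / 4     ≡⟨ cong (_/ 4) (+-assoc 12 (3 * n) 3) ⟩
  (12 + (3 * n + 3)) / 4   ≡⟨ +-distrib-/-∣ˡ {12} (3 * n + 3) {4} (divides 3 refl) ⟩
  3 + (3 * n + 3) / 4      ≡⟨ cong (3 +_) ([3n+3]/4≡n∸n/4 n) ⟩
  3 + (n ∸ n / 4)          ≡⟨ +-∸-assoc 3 (m/n≤m n 4) ⟨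
  (3 + n) ∸ n / 4          ≡⟨ cong ((4 + n) ∸_) (+-distrib-/-∣ˡ {4} n {4} (divides 1 refl)) ⟨
  (4 + n) ∸ (4 + n) / 4    ∎
  where open ≡-Reasoning

mainTheorem4 : ∀ (n p : ℕ) → 3 ≤ n → 2 ≤ p →
    ConvNumberIs (DoubleCorona n p) 2 ((3 * n + 3) / 4)
    × ((3 * n + 3) / 4 ≡ n ∸ n / 4)
mainTheorem4 (suc m) (suc (suc p′)) (s≤s 2≤m) (s≤s (s≤s _)) =
  ((seed , seed-converts , trans seed-size (sym ([3n+3]/4≡n∸n/4 (suc m)))) ,
   λ S conv → 3n≤4s⇒[3n+3]/4≤s {suc m} (LowerBound.three-quarters-bound m (suc (suc p′)) S conv)) ,
  [3n+3]/4≡n∸n/4 (suc m)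
  where open UpperBound m p′ 2≤m
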